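{- Define the map $\mathcal{F}\colon\mathbb{Z}[[y]]\to\mathbb{Z}[[y]]$ by $$(\mathcal{F}\xi)(y)=1+\sum_{n=1}^\infty \frac{y^n}{\prod_{j=1}^n(1-y^j)\,\prod_{j=1}^{n-1}[1-y^j\xi(y)]},$$ and define $\xi_0^{(0)}=1$ and $\xi_0^{(k+1)}=\mathcal{F}\xi_0^{(k)}$ for $k\ge 0$. Let $\xi_0(y)\in\mathbb{Z}[[y]]$ be the unique formal power series with $\Theta_0(-\xi_0(y),y)=0$, where $\Theta_0(x,y)=\sum_{n=0}^\infty x^n y^{n(n-1)/2}$. Then $$\xi_0^{(0)}\preceq\xi_0^{(1)}\preceq\xi_0^{(2)}\preceq\cdots\preceq\xi_0$$ and $\xi_0^{(k)}(y)=\xi_0(y)+O(y^{3k+1})$ for every $k\ge 0$. In particular $\xi_0^{(k)}\to\xi_0$ as $k\to\infty$ in the sense of formal power series (each coefficient eventually stabilizes at its limit), and $\xi_0(y)$ has strictly positive coefficients.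
   Context: For formal power series $f,g$ with real coefficients, $f\preceq g$ means $[y^n]f(y)\le[y^n]g(y)$ for all $n\ge 0$. $O(y^m)$ denotes a formal power series all of whose coefficients of $y^n$ with $n<m$ vanish. The root $\xi_0$ exists and is unique, with constant term $1$, since for any $X(y)$ the composition $\Theta_0(X(y),y)$ is a well-defined formal power series in $y$. -}

module Defs where

open import Data.Nat as ℕ using (ℕ; zero; suc; _∸_; ⌊_/2⌋)
open import Data.Integer using (ℤ; _+_; _*_; -_; 0ℤ; 1ℤ; _≤_)

FPS : Set
FPS = ℕ → ℤ

sumTo : ℕ → (ℕ → ℤ) → ℤ
sumTo zero    f = f 0
sumTo (suc n) f = sumTo n f + f (suc n)

one : FPS
one zero    = 1ℤ
one (suc n) = 0ℤ

add : FPS → FPS → FPS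
add f g n = f n + g n

neg : FPS → FPS
neg f n = - f n

mul : FPS → FPS → FPS
mul f g n = sumTo n (λ i → f i * g (n ∸ i))

pow : FPS → ℕ → FPS
pow f zero    = one
pow f (suc k) = mul f (pow f k)

shift : ℕ → FPS → FPS
shift zero    f         = f
shift (suc k) f zero    = 0ℤ
shift (suc k) f (suc m) = shift k f m

-- 1/(1 - u) = Σ_k u^k, for u with zero constant term
-- (then u^k = O(y^k), so only k ≤ n contributes to [y^n]).
geom : FPS → FPS
geom u n = sumTo n (λ k → pow u k n)

prod1 : ℕ → (ℕ → FPS) → FPS
prod1 zero    h = one
prod1 (suc n) h = mul (prod1 n h) (h (suc n))

-- n-th summand of 𝓕ξ :  y^n / (Π_{j=1}^n (1-y^j) Π_{j=1}^{n-1} (1 - y^j ξ))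
Fterm : FPS → ℕ → FPS
Fterm ξ n = shift n (mul (prod1 n (λ j → geom (shift j one)))
                         (prod1 (n ∸ 1) (λ j → geom (shift j ξ))))

-- (𝓕ξ)(y) = 1 + Σ_{n≥1} Fterm ξ n ; the n-th term is O(y^n),
-- so only n ≤ m contributes to [y^m].
𝓕 : FPS → FPS
𝓕 ξ = add one (λ m → sumTo m (λ i → Fterm ξ (suc i) m))

iterF : ℕ → FPS
iterF zero    = one
iterF (suc k) = 𝓕 (iterF k)

-- Θ_0(-ξ(y), y) = Σ_n (-ξ)^n y^{n(n-1)/2}; the n-th term is O(y^{n-1}),
-- so only n ≤ m+1 contributes to [y^m].
Theta0Neg : FPS → FPS
Theta0Neg ξ m = sumTo (suc m) (λ n → shift ⌊ n ℕ.* (n ∸ 1) /2⌋ (pow (neg ξ) n) m)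

_⪯_ : FPS → FPS → Set
f ⪯ g = ∀ n → f n ≤ g n

-- Everything rests on the identity Θ₀(-a, y) = (y; y)∞ (a y; y)∞ (𝓕 a - a).
-- Put W a = Σₙ yⁿ (a yⁿ; y)∞ / (y; y)ₙ. Termwise, (𝓕 a - a) (a y; y)∞ = W a, and
-- W a + a W(y a) is invariant under a ↦ y a, hence equal to its value
-- Σₙ yⁿ / (y; y)ₙ = 1 / (y; y)∞ at a = 0. So X a = (y; y)∞ W a satisfies
-- X a = 1 - a X(y a), and iterating gives X a = Σₖ (-a)ᵏ y^(k(k-1)/2) = Θ₀(-a, y).
-- Since (y; y)∞ (a y; y)∞ is a unit, the root ξ₀ is a fixed point of 𝓕. On
-- nonnegative series 𝓕 is monotone, and ξ ≡ η mod yᵏ gives 𝓕 ξ ≡ 𝓕 η mod y^(k+3);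
-- hence the iterates increase, agree with ξ₀ below y^(3k+1), and [yⁿ] 𝓕 ξ ≥ 1
-- makes ξ₀ positive.

module Submission where

open import Defs

module _ where
  open import Data.Nat as ℕ using (ℕ; zero; suc; _∸_; z≤n; s≤s; ⌊_/2⌋)
  import Data.Nat.Properties as ℕP
  import Data.Nat.Tactic.RingSolver as ℕSolver
  open import Data.Integer as ℤ using (ℤ; 0ℤ; 1ℤ; _+_; _*_; -_)
  import Data.Integer.Properties as ℤP
  open import Data.Integer.Tactic.RingSolver using (solve-∀)
  open import Data.Maybe using (just; nothing)
  open import Data.Product using (_,_)
  open import Data.Sum using (inj₁; inj₂)
  open import Relation.Nullary using (yes; no)
  open import Relation.Binary.Bundles using (Setoid)
  open import Relation.Binary.Structures using (IsEquivalence)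
  open import Relation.Binary.Definitions using (WeaklyDecidable)
  open import Relation.Binary.PropositionalEquality
  open import Algebra.Bundles using (CommutativeRing)
  open import Algebra.Solver.Ring.AlmostCommutativeRing
    using (_-Raw-AlmostCommutative⟶_; fromCommutativeRing)
  import Algebra.Solver.Ring
  import Relation.Binary.Reasoning.Setoid

  sumTo-cong : ∀ n {f g : ℕ → ℤ} → (∀ i → i ℕ.≤ n → f i ≡ g i) → sumTo n f ≡ sumTo n g
  sumTo-cong zero    eq = eq 0 z≤n
  sumTo-cong (suc n) eq =
    cong₂ _+_ (sumTo-cong n (λ i i≤n → eq i (ℕP.m≤n⇒m≤1+n i≤n))) (eq (suc n) ℕP.≤-refl)

  sumTo-zero : ∀ n {f : ℕ → ℤ} → (∀ i → i ℕ.≤ n → f i ≡ 0ℤ) → sumTo n f ≡ 0ℤ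
  sumTo-zero zero    eq = eq 0 z≤n
  sumTo-zero (suc n) eq =
    cong₂ _+_ (sumTo-zero n (λ i i≤n → eq i (ℕP.m≤n⇒m≤1+n i≤n))) (eq (suc n) ℕP.≤-refl)

  sumTo-+ : ∀ n f g → sumTo n (λ i → f i + g i) ≡ sumTo n f + sumTo n g
  sumTo-+ zero    f g = refl
  sumTo-+ (suc n) f g = trans (cong (_+ (f (suc n) + g (suc n))) (sumTo-+ n f g))
                              (+-interchange (sumTo n f) (sumTo n g) (f (suc n)) (g (suc n)))
    where
    +-interchange : ∀ a b c d → (a + b) + (c + d) ≡ (a + c) + (b + d)
    +-interchange = solve-∀

  *-distribˡ-sumTo : ∀ n c f → c * sumTo n f ≡ sumTo n (λ i → c * f i)
  *-distribˡ-sumTo zero    c f = refl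
  *-distribˡ-sumTo (suc n) c f =
    trans (ℤP.*-distribˡ-+ c (sumTo n f) (f (suc n))) (cong (_+ c * f (suc n)) (*-distribˡ-sumTo n c f))

  neg-sumTo : ∀ n f → - sumTo n f ≡ sumTo n (λ i → - f i)
  neg-sumTo zero    f = refl
  neg-sumTo (suc n) f =
    trans (ℤP.neg-distrib-+ (sumTo n f) (f (suc n))) (cong (_+ - f (suc n)) (neg-sumTo n f))

  sumTo-unfoldˡ : ∀ n f → sumTo (suc n) f ≡ f 0 + sumTo n (λ i → f (suc i))
  sumTo-unfoldˡ zero    f = refl
  sumTo-unfoldˡ (suc n) f = trans (cong (_+ f (suc (suc n))) (sumTo-unfoldˡ n f))
                                  (ℤP.+-assoc (f 0) (sumTo n (λ i → f (suc i))) (f (suc (suc n))))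

  sumTo-reverse : ∀ n f → sumTo n f ≡ sumTo n (λ i → f (n ∸ i))
  sumTo-reverse zero    f = refl
  sumTo-reverse (suc n) f = trans (cong (_+ f (suc n)) (sumTo-reverse n f))
    (trans (ℤP.+-comm (sumTo n (λ i → f (n ∸ i))) (f (suc n)))
           (sym (sumTo-unfoldˡ n (λ i → f (suc n ∸ i)))))

  sumTo-swap : ∀ n m (F : ℕ → ℕ → ℤ) →
               sumTo n (λ i → sumTo m (F i)) ≡ sumTo m (λ j → sumTo n (λ i → F i j))
  sumTo-swap zero    m F = refl
  sumTo-swap (suc n) m F = trans (cong (_+ sumTo m (F (suc n))) (sumTo-swap n m F))
                                 (sym (sumTo-+ m (λ j → sumTo n (λ i → F i j)) (F (suc n))))

  sumTo-extend : ∀ {n N} f → n ℕ.≤ N → (∀ i → n ℕ.< i → i ℕ.≤ N → f i ≡ 0ℤ) → sumTo N f ≡ sumTo n f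
  sumTo-extend {n} f n≤N = go (ℕP.≤⇒≤′ n≤N)
    where
    go : ∀ {N} → n ℕ.≤′ N → (∀ i → n ℕ.< i → i ℕ.≤ N → f i ≡ 0ℤ) → sumTo N f ≡ sumTo n f
    go ℕ.≤′-refl          _     = refl
    go (ℕ.≤′-step {N} p) zeros =
      trans (cong (sumTo N f +_) (zeros (suc N) (s≤s (ℕP.≤′⇒≤ p)) ℕP.≤-refl))
            (trans (ℤP.+-identityʳ _) (go p (λ i n<i i≤N → zeros i n<i (ℕP.m≤n⇒m≤1+n i≤N))))

  sumBelow : ℕ → (ℕ → ℤ) → ℤ
  sumBelow zero    f = 0ℤ
  sumBelow (suc K) f = sumBelow K f + f K

  sumTo≡sumBelow : ∀ N f → sumTo N f ≡ sumBelow (suc N) f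
  sumTo≡sumBelow zero    f = sym (ℤP.+-identityˡ (f 0))
  sumTo≡sumBelow (suc N) f = cong (_+ f (suc N)) (sumTo≡sumBelow N f)

  -- The ring of formal power series

  infix 4 _≈_
  record _≈_ (f g : FPS) : Set where
    constructor mk≈
    field at : ∀ n → f n ≡ g n
  open _≈_ public

  ≈-refl : ∀ {f} → f ≈ f
  ≈-refl = mk≈ λ _ → refl

  ≈-sym : ∀ {f g} → f ≈ g → g ≈ f
  ≈-sym e = mk≈ λ n → sym (at e n)

  ≈-trans : ∀ {f g h} → f ≈ g → g ≈ h → f ≈ h
  ≈-trans e e′ = mk≈ λ n → trans (at e n) (at e′ n)

  ≈-isEquivalence : IsEquivalence _≈_
  ≈-isEquivalence = record { refl = ≈-refl ; sym = ≈-sym ; trans = ≈-trans }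

  FPS-setoid : Setoid _ _
  FPS-setoid = record { isEquivalence = ≈-isEquivalence }

  module ≈-Reasoning = Relation.Binary.Reasoning.Setoid FPS-setoid

  zeroₛ : FPS
  zeroₛ _ = 0ℤ

  tail : FPS → FPS
  tail f n = f (suc n)

  scale : ℤ → FPS → FPS
  scale c f n = c * f n

  add-cong : ∀ {f f′ g g′} → f ≈ f′ → g ≈ g′ → add f g ≈ add f′ g′
  add-cong e e′ = mk≈ λ n → cong₂ _+_ (at e n) (at e′ n)

  neg-cong : ∀ {f f′} → f ≈ f′ → neg f ≈ neg f′
  neg-cong e = mk≈ λ n → cong -_ (at e n)

  mul-cong : ∀ {f f′ g g′} → f ≈ f′ → g ≈ g′ → mul f g ≈ mul f′ g′
  mul-cong e e′ = mk≈ λ n → sumTo-cong n (λ i _ → cong₂ _*_ (at e i) (at e′ (n ∸ i)))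

  add-congˡ : ∀ f {g g′} → g ≈ g′ → add f g ≈ add f g′
  add-congˡ f = add-cong {f} ≈-refl

  add-congʳ : ∀ g {f f′} → f ≈ f′ → add f g ≈ add f′ g
  add-congʳ g e = add-cong {g = g} e ≈-refl

  mul-congˡ : ∀ f {g g′} → g ≈ g′ → mul f g ≈ mul f g′
  mul-congˡ f = mul-cong {f} ≈-refl

  mul-congʳ : ∀ g {f f′} → f ≈ f′ → mul f g ≈ mul f′ g
  mul-congʳ g e = mul-cong {g = g} e ≈-refl

  mul-comm : ∀ f g → mul f g ≈ mul g f
  mul-comm f g = mk≈ λ n → trans (sumTo-reverse n (λ i → f i * g (n ∸ i))) (sumTo-cong n λ i i≤n →
    trans (ℤP.*-comm (f (n ∸ i)) (g (n ∸ (n ∸ i)))) (cong (λ j → g j * f (n ∸ i)) (ℕP.m∸[m∸n]≡n i≤n)))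

  mul-suc : ∀ f g n → mul f g (suc n) ≡ f 0 * g (suc n) + mul (tail f) g n
  mul-suc f g n = sumTo-unfoldˡ n (λ i → f i * g (suc n ∸ i))

  mul-distribˡ : ∀ f g h → mul f (add g h) ≈ add (mul f g) (mul f h)
  mul-distribˡ f g h = mk≈ λ n →
    trans (sumTo-cong n (λ i _ → ℤP.*-distribˡ-+ (f i) (g (n ∸ i)) (h (n ∸ i)))) (sumTo-+ n _ _)

  mul-distribʳ : ∀ f g h → mul (add g h) f ≈ add (mul g f) (mul h f)
  mul-distribʳ f g h = ≈-trans (mul-comm (add g h) f)
    (≈-trans (mul-distribˡ f g h) (add-cong (mul-comm f g) (mul-comm f h)))

  mul-scaleˡ : ∀ c f g → mul (scale c f) g ≈ scale c (mul f g)
  mul-scaleˡ c f g = mk≈ λ n →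
    trans (sumTo-cong n (λ i _ → ℤP.*-assoc c (f i) (g (n ∸ i)))) (sym (*-distribˡ-sumTo n c _))

  mul-negˡ : ∀ f g → mul (neg f) g ≈ neg (mul f g)
  mul-negˡ f g = mk≈ λ n →
    trans (sumTo-cong n (λ i _ → sym (ℤP.neg-distribˡ-* (f i) (g (n ∸ i))))) (sym (neg-sumTo n _))

  mul-zeroˡ : ∀ f → mul zeroₛ f ≈ zeroₛ
  mul-zeroˡ f = mk≈ λ n → sumTo-zero n (λ i _ → ℤP.*-zeroˡ (f (n ∸ i)))

  mul-zeroʳ : ∀ f → mul f zeroₛ ≈ zeroₛ
  mul-zeroʳ f = ≈-trans (mul-comm f zeroₛ) (mul-zeroˡ f)

  mul-identityˡ : ∀ f → mul one f ≈ f
  mul-identityˡ f = mk≈ coeff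
    where
    coeff : ∀ n → mul one f n ≡ f n
    coeff zero    = ℤP.*-identityˡ (f 0)
    coeff (suc n) = trans (mul-suc one f n)
      (trans (cong₂ _+_ (ℤP.*-identityˡ (f (suc n))) (at (mul-zeroˡ f) n)) (ℤP.+-identityʳ _))

  mul-identityʳ : ∀ f → mul f one ≈ f
  mul-identityʳ f = ≈-trans (mul-comm f one) (mul-identityˡ f)

  -- Induction on the degree, peeling off the constant term of the left factor.
  mul-assoc : ∀ f g h → mul (mul f g) h ≈ mul f (mul g h)
  mul-assoc f g h = mk≈ (coeff f)
    where
    rearrange : ∀ a b c d e → (a * b) * c + (a * d + e) ≡ a * (b * c + d) + e
    rearrange = solve-∀

    coeff : ∀ f n → mul (mul f g) h n ≡ mul f (mul g h) n
    coeff f zero    = ℤP.*-assoc (f 0) (g 0) (h 0)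
    coeff f (suc n) = begin
      mul (mul f g) h (suc n)
        ≡⟨ mul-suc (mul f g) h n ⟩
      (f 0 * g 0) * h (suc n) + mul (tail (mul f g)) h n
        ≡⟨ cong ((f 0 * g 0) * h (suc n) +_) (at (mul-cong {g = h} (mk≈ (mul-suc f g)) ≈-refl) n) ⟩
      (f 0 * g 0) * h (suc n) + mul (add (scale (f 0) (tail g)) (mul (tail f) g)) h n
        ≡⟨ cong ((f 0 * g 0) * h (suc n) +_) (trans (at (mul-distribʳ h (scale (f 0) (tail g)) (mul (tail f) g)) n)
              (cong₂ _+_ (at (mul-scaleˡ (f 0) (tail g) h) n) (coeff (tail f) n))) ⟩
      (f 0 * g 0) * h (suc n) + (f 0 * mul (tail g) h n + mul (tail f) (mul g h) n)
        ≡⟨ rearrange (f 0) (g 0) (h (suc n)) (mul (tail g) h n) (mul (tail f) (mul g h) n) ⟩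
      f 0 * (g 0 * h (suc n) + mul (tail g) h n) + mul (tail f) (mul g h) n
        ≡⟨ cong (λ x → f 0 * x + mul (tail f) (mul g h) n) (mul-suc g h n) ⟨
      f 0 * mul g h (suc n) + mul (tail f) (mul g h) n
        ≡⟨ mul-suc f (mul g h) n ⟨
      mul f (mul g h) (suc n) ∎
      where open ≡-Reasoning

  open import Algebra.Structures {A = FPS} _≈_ using (IsCommutativeRing)

  FPS-isCommutativeRing : IsCommutativeRing add mul neg zeroₛ one
  FPS-isCommutativeRing = record
    { isRing = record
      { +-isAbelianGroup = record
        { isGroup = record
          { isMonoid = record
            { isSemigroup = record
              { isMagma = record { isEquivalence = ≈-isEquivalence ; ∙-cong = add-cong }
              ; assoc = λ f g h → mk≈ λ n → ℤP.+-assoc (f n) (g n) (h n) }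
            ; identity = (λ f → mk≈ λ n → ℤP.+-identityˡ (f n)) , (λ f → mk≈ λ n → ℤP.+-identityʳ (f n)) }
          ; inverse = (λ f → mk≈ λ n → ℤP.+-inverseˡ (f n)) , (λ f → mk≈ λ n → ℤP.+-inverseʳ (f n))
          ; ⁻¹-cong = neg-cong }
        ; comm = λ f g → mk≈ λ n → ℤP.+-comm (f n) (g n) }
      ; *-cong = mul-cong
      ; *-assoc = mul-assoc
      ; *-identity = mul-identityˡ , mul-identityʳ
      ; distrib = mul-distribˡ , mul-distribʳ }
    ; *-comm = mul-comm }

  FPS-commutativeRing : CommutativeRing _ _
  FPS-commutativeRing = record { isCommutativeRing = FPS-isCommutativeRing }

  constant : ℤ → FPS
  constant c zero    = c
  constant c (suc n) = 0ℤ

  constant-+ : ∀ a b → constant (a + b) ≈ add (constant a) (constant b)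
  constant-+ a b = mk≈ λ { zero → refl ; (suc n) → sym (ℤP.+-identityʳ 0ℤ) }

  constant-* : ∀ a b → constant (a * b) ≈ mul (constant a) (constant b)
  constant-* a b = mk≈ λ { zero → refl ; (suc n) → sym (trans (mul-suc (constant a) (constant b) n)
                     (trans (cong₂ _+_ (ℤP.*-zeroʳ a) (at (mul-zeroˡ (constant b)) n)) (ℤP.+-identityʳ 0ℤ))) }

  constant-neg : ∀ a → constant (- a) ≈ neg (constant a)
  constant-neg a = mk≈ λ { zero → refl ; (suc n) → refl }

  -- The solver reads a coefficient c as ⟦ c ⟧; sending 1ℤ to one itself makes
  -- its constant 1 definitionally the unit series.
  ⟦_⟧ : ℤ → FPS
  ⟦ ℤ.pos 1 ⟧ = one
  ⟦ c ⟧       = constant c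

  ⟦⟧≈constant : ∀ c → ⟦ c ⟧ ≈ constant c
  ⟦⟧≈constant (ℤ.pos 0)             = ≈-refl
  ⟦⟧≈constant (ℤ.pos 1)             = mk≈ λ { zero → refl ; (suc n) → refl }
  ⟦⟧≈constant (ℤ.pos (suc (suc n))) = ≈-refl
  ⟦⟧≈constant (ℤ.negsuc n)          = ≈-refl

  ⟦⟧-homomorphism : ℤ.+-*-rawRing -Raw-AlmostCommutative⟶ fromCommutativeRing FPS-commutativeRing
  ⟦⟧-homomorphism = record
    { ⟦_⟧    = ⟦_⟧
    ; +-homo = λ a b → via (a + b) (≈-trans (constant-+ a b) (add-cong (≈-sym (⟦⟧≈constant a)) (≈-sym (⟦⟧≈constant b))))
    ; *-homo = λ a b → via (a * b) (≈-trans (constant-* a b) (mul-cong (≈-sym (⟦⟧≈constant a)) (≈-sym (⟦⟧≈constant b))))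
    ; -‿homo = λ a → via (- a) (≈-trans (constant-neg a) (neg-cong (≈-sym (⟦⟧≈constant a))))
    ; 0-homo = mk≈ λ { zero → refl ; (suc n) → refl }
    ; 1-homo = ≈-refl }
    where
    via : ∀ c {f} → constant c ≈ f → ⟦ c ⟧ ≈ f
    via c = ≈-trans (⟦⟧≈constant c)

  ⟦⟧-≟ : WeaklyDecidable (λ a b → ⟦ a ⟧ ≈ ⟦ b ⟧)
  ⟦⟧-≟ a b with a ℤP.≟ b
  ... | yes refl = just ≈-refl
  ... | no _     = nothing

  open Algebra.Solver.Ring ℤ.+-*-rawRing (fromCommutativeRing FPS-commutativeRing)
    ⟦⟧-homomorphism ⟦⟧-≟
    using (solve; _:=_; _:+_; _:*_; :-_; _:-_; con)

  1-_ : FPS → FPS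
  1- u = add one (neg u)

  1-cong : ∀ {f g} → f ≈ g → 1- f ≈ 1- g
  1-cong e = add-congˡ one (neg-cong e)

  y^_ : ℕ → FPS
  y^ k = shift k one

  shift-cong : ∀ k {f g} → f ≈ g → shift k f ≈ shift k g
  shift-cong k {f} {g} e = mk≈ (coeff k)
    where
    coeff : ∀ k n → shift k f n ≡ shift k g n
    coeff zero    n       = at e n
    coeff (suc k) zero    = refl
    coeff (suc k) (suc n) = coeff k n

  shift-shift : ∀ i j f → shift i (shift j f) ≈ shift (i ℕ.+ j) f
  shift-shift i j f = mk≈ (coeff i)
    where
    coeff : ∀ i n → shift i (shift j f) n ≡ shift (i ℕ.+ j) f n
    coeff zero    n       = refl
    coeff (suc i) zero    = refl
    coeff (suc i) (suc n) = coeff i n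

  shift-suc : ∀ k f → shift (suc k) f ≈ shift k (shift 1 f)
  shift-suc k f = mk≈ (coeff k)
    where
    coeff : ∀ k n → shift (suc k) f n ≡ shift k (shift 1 f) n
    coeff zero    n       = refl
    coeff (suc k) zero    = refl
    coeff (suc k) (suc n) = coeff k n

  shift-neg : ∀ k f → neg (shift k f) ≈ shift k (neg f)
  shift-neg k f = mk≈ (coeff k)
    where
    coeff : ∀ k n → neg (shift k f) n ≡ shift k (neg f) n
    coeff zero    n       = refl
    coeff (suc k) zero    = refl
    coeff (suc k) (suc n) = coeff k n

  mul-shiftˡ : ∀ k f g → mul (shift k f) g ≈ shift k (mul f g)
  mul-shiftˡ zero    f g = ≈-refl
  mul-shiftˡ (suc k) f g = begin
    mul (shift (suc k) f) g            ≈⟨ mul-congʳ g (shift-shift 1 k f) ⟨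
    mul (shift 1 (shift k f)) g        ≈⟨ mk≈ (mul-shift₁ (shift k f)) ⟩
    shift 1 (mul (shift k f) g)        ≈⟨ shift-cong 1 (mul-shiftˡ k f g) ⟩
    shift 1 (shift k (mul f g))        ≈⟨ shift-shift 1 k (mul f g) ⟩
    shift (suc k) (mul f g)            ∎
    where
    open ≈-Reasoning
    mul-shift₁ : ∀ h n → mul (shift 1 h) g n ≡ shift 1 (mul h g) n
    mul-shift₁ h zero    = ℤP.*-zeroˡ (g 0)
    mul-shift₁ h (suc n) = trans (mul-suc (shift 1 h) g n)
      (trans (cong (_+ mul h g n) (ℤP.*-zeroˡ (g (suc n)))) (ℤP.+-identityˡ _))

  mul-shiftʳ : ∀ k f g → mul f (shift k g) ≈ shift k (mul f g)
  mul-shiftʳ k f g =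
    ≈-trans (mul-comm f (shift k g)) (≈-trans (mul-shiftˡ k g f) (shift-cong k (mul-comm g f)))

  shift≈y^* : ∀ k f → shift k f ≈ mul (y^ k) f
  shift≈y^* k f = ≈-sym (≈-trans (mul-shiftˡ k one f) (shift-cong k (mul-identityˡ f)))

  y^-+ : ∀ i j → mul (y^ i) (y^ j) ≈ y^ (i ℕ.+ j)
  y^-+ i j = ≈-trans (mul-shiftˡ i one (y^ j)) (≈-trans (shift-cong i (mul-identityˡ (y^ j))) (shift-shift i j one))

  shift-diagonal : ∀ n f → shift n f n ≡ f 0
  shift-diagonal zero    f = refl
  shift-diagonal (suc n) f = shift-diagonal n f

  -- Order of vanishing and truncated agreement

  infix 4 _∈O[y^_] _≡[<_]_

  _∈O[y^_] : FPS → ℕ → Set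
  f ∈O[y^ k ] = ∀ n → n ℕ.< k → f n ≡ 0ℤ

  _≡[<_]_ : FPS → ℕ → FPS → Set
  f ≡[< k ] g = ∀ n → n ℕ.< k → f n ≡ g n

  ∈O-mono : ∀ {j k f} → j ℕ.≤ k → f ∈O[y^ k ] → f ∈O[y^ j ]
  ∈O-mono j≤k o n n<j = o n (ℕP.<-≤-trans n<j j≤k)

  ∈O-≈ : ∀ {k f g} → f ≈ g → f ∈O[y^ k ] → g ∈O[y^ k ]
  ∈O-≈ e o n n<k = trans (sym (at e n)) (o n n<k)

  ∈O-add : ∀ {k f g} → f ∈O[y^ k ] → g ∈O[y^ k ] → add f g ∈O[y^ k ]
  ∈O-add of og n n<k = trans (cong₂ _+_ (of n n<k) (og n n<k)) (ℤP.+-identityʳ 0ℤ)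

  ∈O-mul : ∀ {i j f g} → f ∈O[y^ i ] → g ∈O[y^ j ] → mul f g ∈O[y^ i ℕ.+ j ]
  ∈O-mul {i} {j} {f} {g} of og n n<i+j = sumTo-zero n term
    where
    term : ∀ l → l ℕ.≤ n → f l * g (n ∸ l) ≡ 0ℤ
    term l l≤n with l ℕ.<? i
    ... | yes l<i = trans (cong (_* g (n ∸ l)) (of l l<i)) (ℤP.*-zeroˡ (g (n ∸ l)))
    ... | no  l≮i = trans (cong (f l *_) (og (n ∸ l) n∸l<j)) (ℤP.*-zeroʳ (f l))
      where
      i≤n : i ℕ.≤ n
      i≤n = ℕP.≤-trans (ℕP.≮⇒≥ l≮i) l≤n
      n∸l<j : n ∸ l ℕ.< j
      n∸l<j = ℕP.≤-<-trans (ℕP.∸-monoʳ-≤ n (ℕP.≮⇒≥ l≮i))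
        (ℕP.+-cancelˡ-< i (n ∸ i) j (subst (ℕ._< i ℕ.+ j) (sym (ℕP.m+[n∸m]≡n i≤n)) n<i+j))

  mul-∈Oˡ : ∀ {j g} f → g ∈O[y^ j ] → mul f g ∈O[y^ j ]
  mul-∈Oˡ f og = ∈O-mul {0} {f = f} (λ _ ()) og

  mul-∈Oʳ : ∀ {j f} g → f ∈O[y^ j ] → mul f g ∈O[y^ j ]
  mul-∈Oʳ {f = f} g of = ∈O-≈ (mul-comm g f) (mul-∈Oˡ g of)

  ∈O-shift : ∀ k {i f} → f ∈O[y^ i ] → shift k f ∈O[y^ k ℕ.+ i ]
  ∈O-shift zero    of             = of
  ∈O-shift (suc k) of zero    _         = refl
  ∈O-shift (suc k) of (suc n) (s≤s n<k+i) = ∈O-shift k of n n<k+i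

  shift-∈O : ∀ k f → shift k f ∈O[y^ k ]
  shift-∈O k f n n<k = ∈O-shift k {0} {f} (λ _ ()) n (subst (n ℕ.<_) (sym (ℕP.+-identityʳ k)) n<k)

  pow-∈O : ∀ {u} → u ∈O[y^ 1 ] → ∀ k → pow u k ∈O[y^ k ]
  pow-∈O ou zero    = λ _ ()
  pow-∈O ou (suc k) = ∈O-mul ou (pow-∈O ou k)

  ≡[<]-refl : ∀ {k f} → f ≡[< k ] f
  ≡[<]-refl _ _ = refl

  ≡[<]-trans : ∀ {k f g h} → f ≡[< k ] g → g ≡[< k ] h → f ≡[< k ] h
  ≡[<]-trans a b n n<k = trans (a n n<k) (b n n<k)

  ≈⇒≡[<] : ∀ {k f g} → f ≈ g → f ≡[< k ] g
  ≈⇒≡[<] e n _ = at e n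

  ≡[<]⇒≈ : ∀ {f g} → (∀ m → f ≡[< suc m ] g) → f ≈ g
  ≡[<]⇒≈ a = mk≈ λ m → a m m ℕP.≤-refl

  ≡[<]-mono : ∀ {j k f g} → j ℕ.≤ k → f ≡[< k ] g → f ≡[< j ] g
  ≡[<]-mono j≤k a n n<j = a n (ℕP.<-≤-trans n<j j≤k)

  ≡[<]-add : ∀ {k f f′ g g′} → f ≡[< k ] f′ → g ≡[< k ] g′ → add f g ≡[< k ] add f′ g′
  ≡[<]-add a b n n<k = cong₂ _+_ (a n n<k) (b n n<k)

  ≡[<]-mul : ∀ {k f f′ g g′} → f ≡[< k ] f′ → g ≡[< k ] g′ → mul f g ≡[< k ] mul f′ g′
  ≡[<]-mul a b n n<k = sumTo-cong n λ i i≤n →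
    cong₂ _*_ (a i (ℕP.≤-<-trans i≤n n<k)) (b (n ∸ i) (ℕP.≤-<-trans (ℕP.m∸n≤m n i) n<k))

  ≡[<]-shift : ∀ j {k f g} → f ≡[< k ] g → shift j f ≡[< j ℕ.+ k ] shift j g
  ≡[<]-shift zero    a                   = a
  ≡[<]-shift (suc j) a zero    _         = refl
  ≡[<]-shift (suc j) a (suc n) (s≤s n<j+k) = ≡[<]-shift j a n n<j+k

  ≡[<]-mul-one : ∀ {k f h} → h ≡[< k ] one → mul f h ≡[< k ] f
  ≡[<]-mul-one {f = f} a = ≡[<]-trans (≡[<]-mul {f = f} ≡[<]-refl a) (≈⇒≡[<] (mul-identityʳ f))

  1-∈O : ∀ {k f} → f ∈O[y^ k ] → 1- f ≡[< k ] one
  1-∈O {f = f} of n n<k = trans (cong (λ c → one n + - c) (of n n<k)) (ℤP.+-identityʳ (one n))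

  LocallyFinite : (ℕ → FPS) → Set
  LocallyFinite T = ∀ n → T n ∈O[y^ n ]

  -- Σₙ Tₙ for a locally finite family: only the terms n ≤ m contribute to [y^m].
  ∑ : (ℕ → FPS) → FPS
  ∑ T m = sumTo m (λ n → T n m)

  ∑-extend : ∀ {T} → LocallyFinite T → ∀ {m N} → m ℕ.≤ N → sumTo N (λ n → T n m) ≡ ∑ T m
  ∑-extend {T} fin {m} m≤N = sumTo-extend (λ n → T n m) m≤N (λ n m<n _ → fin n m m<n)

  ∑-cong : ∀ {T U} → (∀ n → T n ≈ U n) → ∑ T ≈ ∑ U
  ∑-cong e = mk≈ λ m → sumTo-cong m (λ n _ → at (e n) m)

  ∑-add : ∀ T U → ∑ (λ n → add (T n) (U n)) ≈ add (∑ T) (∑ U)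
  ∑-add T U = mk≈ λ m → sumTo-+ m (λ n → T n m) (λ n → U n m)

  mul-∑ : ∀ f {T} → LocallyFinite T → mul f (∑ T) ≈ ∑ (λ n → mul f (T n))
  mul-∑ f {T} fin = mk≈ λ m → begin
    sumTo m (λ i → f i * ∑ T (m ∸ i))
      ≡⟨ sumTo-cong m (λ i _ → cong (f i *_) (sym (∑-extend fin (ℕP.m∸n≤m m i)))) ⟩
    sumTo m (λ i → f i * sumTo m (λ n → T n (m ∸ i)))
      ≡⟨ sumTo-cong m (λ i _ → *-distribˡ-sumTo m (f i) (λ n → T n (m ∸ i))) ⟩
    sumTo m (λ i → sumTo m (λ n → f i * T n (m ∸ i)))
      ≡⟨ sumTo-swap m m (λ i n → f i * T n (m ∸ i)) ⟩
    ∑ (λ n → mul f (T n)) m ∎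
    where open ≡-Reasoning

  ∑-unfoldˡ : ∀ T → LocallyFinite T → ∑ T ≈ add (T 0) (∑ (λ n → T (suc n)))
  ∑-unfoldˡ T fin = mk≈ coeff
    where
    coeff : ∀ m → ∑ T m ≡ add (T 0) (∑ (λ n → T (suc n))) m
    coeff zero    = sym (trans (cong (T 0 0 +_) (fin 1 0 (s≤s z≤n))) (ℤP.+-identityʳ (T 0 0)))
    coeff (suc m) = trans (sumTo-unfoldˡ m (λ n → T n (suc m))) (cong (T 0 (suc m) +_)
      (sym (sumTo-extend (λ n → T (suc n) (suc m)) (ℕP.n≤1+n m) (λ n m<n _ → fin (suc n) (suc m) (s≤s m<n)))))

  ∑-≡[<] : ∀ {k T U} → (∀ n → T n ≡[< k ] U n) → ∑ T ≡[< k ] ∑ U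
  ∑-≡[<] a m m<k = sumTo-cong m (λ n _ → a n m m<k)

  geom-inverse : ∀ u → u ∈O[y^ 1 ] → mul (geom u) (1- u) ≈ one
  geom-inverse u ou = begin
    mul (geom u) (1- u)                         ≈⟨ mul-comm (geom u) (1- u) ⟩
    mul (1- u) (geom u)                         ≈⟨ mul-distribʳ (geom u) one (neg u) ⟩
    add (mul one (geom u)) (mul (neg u) (geom u))
      ≈⟨ add-cong (mul-identityˡ (geom u)) (≈-trans (mul-negˡ u (geom u)) (neg-cong (mul-∑ u (pow-∈O ou)))) ⟩
    add (geom u) (neg S)                        ≈⟨ add-cong (∑-unfoldˡ (pow u) (pow-∈O ou)) ≈-refl ⟩
    add (add one S) (neg S)                     ≈⟨ solve 2 (λ o s → (o :+ s) :- s := o) ≈-refl one S ⟩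
    one                                         ∎
    where
    open ≈-Reasoning
    S = ∑ (λ k → pow u (suc k))

  prod1-cong : ∀ n {h h′} → (∀ j → h (suc j) ≈ h′ (suc j)) → prod1 n h ≈ prod1 n h′
  prod1-cong zero    e = ≈-refl
  prod1-cong (suc n) {h} {h′} e = mul-cong (prod1-cong n {h} {h′} e) (e n)

  prod1-mul : ∀ n h h′ → prod1 n (λ j → mul (h j) (h′ j)) ≈ mul (prod1 n h) (prod1 n h′)
  prod1-mul zero    h h′ = ≈-sym (mul-identityˡ one)
  prod1-mul (suc n) h h′ = ≈-trans (mul-congʳ (mul (h (suc n)) (h′ (suc n))) (prod1-mul n h h′))
    (solve 4 (λ a b c d → (a :* b) :* (c :* d) := (a :* c) :* (b :* d)) ≈-refl
      (prod1 n h) (prod1 n h′) (h (suc n)) (h′ (suc n)))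

  prod1-one : ∀ n {h} → (∀ j → h (suc j) ≈ one) → prod1 n h ≈ one
  prod1-one zero    e = ≈-refl
  prod1-one (suc n) {h} e = ≈-trans (mul-cong (prod1-one n {h} e) (e n)) (mul-identityˡ one)

  prod1-unfoldˡ : ∀ n h → prod1 (suc n) h ≈ mul (h 1) (prod1 n (λ j → h (suc j)))
  prod1-unfoldˡ zero    h = ≈-trans (mul-identityˡ (h 1)) (≈-sym (mul-identityʳ (h 1)))
  prod1-unfoldˡ (suc n) h = ≈-trans (mul-congʳ (h (suc (suc n))) (prod1-unfoldˡ n h))
    (mul-assoc (h 1) (prod1 n (λ j → h (suc j))) (h (suc (suc n))))

  prod1-≡[<] : ∀ n {k h h′} → (∀ j → h (suc j) ≡[< k ] h′ (suc j)) → prod1 n h ≡[< k ] prod1 n h′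
  prod1-≡[<] zero    a = ≡[<]-refl
  prod1-≡[<] (suc n) {h = h} {h′} a = ≡[<]-mul (prod1-≡[<] n {h = h} {h′} a) (a n)

  prod1-geom-inverse : ∀ n (u : ℕ → FPS) → (∀ j → u (suc j) ∈O[y^ 1 ]) →
                       mul (prod1 n (λ j → geom (u j))) (prod1 n (λ j → 1- u j)) ≈ one
  prod1-geom-inverse n u ou = begin
    mul (prod1 n (λ j → geom (u j))) (prod1 n (λ j → 1- u j))  ≈⟨ prod1-mul n (λ j → geom (u j)) (λ j → 1- u j) ⟨
    prod1 n (λ j → mul (geom (u j)) (1- u j))                  ≈⟨ prod1-one n (λ j → geom-inverse (u (suc j)) (ou j)) ⟩
    one                                                        ∎
    where open ≈-Reasoning

  ConvergentFactors : (ℕ → FPS) → Set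
  ConvergentFactors h = ∀ j → h j ≡[< j ] one

  prod1-stable : ∀ {h} → ConvergentFactors h → ∀ {M N} → M ℕ.≤ N → prod1 N h ≡[< suc M ] prod1 M h
  prod1-stable {h} conv {M} M≤N = go (ℕP.≤⇒≤′ M≤N)
    where
    go : ∀ {N} → M ℕ.≤′ N → prod1 N h ≡[< suc M ] prod1 M h
    go ℕ.≤′-refl         = ≡[<]-refl
    go (ℕ.≤′-step {N} p) = ≡[<]-trans (≡[<]-mul-one {f = prod1 N h} (≡[<]-mono (s≤s (ℕP.≤′⇒≤ p)) (conv (suc N)))) (go p)

  ∏ : (ℕ → FPS) → FPS
  ∏ h m = prod1 m h m

  ∏-≡[<]-prod1 : ∀ {h} → ConvergentFactors h → ∀ M → ∏ h ≡[< suc M ] prod1 M h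
  ∏-≡[<]-prod1 conv M n n<1+M = sym (prod1-stable conv (ℕP.≤-pred n<1+M) n ℕP.≤-refl)

  ∏-cong : ∀ {h h′} → (∀ j → h (suc j) ≈ h′ (suc j)) → ∏ h ≈ ∏ h′
  ∏-cong e = mk≈ λ m → at (prod1-cong m e) m

  ∏-unfoldˡ : ∀ h → ConvergentFactors h → ∏ h ≈ mul (h 1) (∏ (λ j → h (suc j)))
  ∏-unfoldˡ h conv = mk≈ λ m → sym (begin
    mul (h 1) (∏ h₊) m          ≡⟨ ≡[<]-mul {f = h 1} ≡[<]-refl (∏-≡[<]-prod1 conv₊ m) m ℕP.≤-refl ⟩
    mul (h 1) (prod1 m h₊) m    ≡⟨ at (prod1-unfoldˡ m h) m ⟨
    prod1 (suc m) h m           ≡⟨ prod1-stable conv (ℕP.n≤1+n m) m ℕP.≤-refl ⟩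
    ∏ h m                       ∎)
    where
    open ≡-Reasoning
    h₊ = λ j → h (suc j)
    conv₊ : ConvergentFactors h₊
    conv₊ j = ≡[<]-mono (ℕP.n≤1+n j) (conv (suc j))

  ∏-≡[<]-one : ∀ {k h} → (∀ j → h (suc j) ≡[< k ] one) → ∏ h ≡[< k ] one
  ∏-≡[<]-one a n n<k = go n a n n<k
    where
    go : ∀ n {k h} → (∀ j → h (suc j) ≡[< k ] one) → prod1 n h ≡[< k ] one
    go zero    a = ≡[<]-refl
    go (suc n) a = ≡[<]-trans (≡[<]-mul (go n a) (a n)) (≈⇒≡[<] (mul-identityˡ one))

  pochFactor : FPS → ℕ → FPS
  pochFactor b j = 1- shift j b

  poch∞ : FPS → FPS
  poch∞ b = ∏ (pochFactor b)

  poch∞-cong : ∀ {b b′} → b ≈ b′ → poch∞ b ≈ poch∞ b′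
  poch∞-cong e = ∏-cong (λ j → 1-cong (shift-cong (suc j) e))

  poch∞-unfold : ∀ b → poch∞ b ≈ mul (1- shift 1 b) (poch∞ (shift 1 b))
  poch∞-unfold b = ≈-trans (∏-unfoldˡ (pochFactor b) (λ j → 1-∈O (shift-∈O j b)))
    (mul-congˡ (1- shift 1 b) (∏-cong (λ j → 1-cong (shift-suc (suc j) b))))

  poch∞-split : ∀ n b → poch∞ b ≈ mul (prod1 n (pochFactor b)) (poch∞ (shift n b))
  poch∞-split zero    b = ≈-sym (mul-identityˡ (poch∞ b))
  poch∞-split (suc n) b = begin
    poch∞ b
      ≈⟨ poch∞-split n b ⟩
    mul P (poch∞ (shift n b))
      ≈⟨ mul-congˡ P (poch∞-unfold (shift n b)) ⟩
    mul P (mul (1- shift 1 (shift n b)) (poch∞ (shift 1 (shift n b))))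
      ≈⟨ mul-congˡ P (mul-cong (1-cong (shift-shift 1 n b)) (poch∞-cong (shift-shift 1 n b))) ⟩
    mul P (mul (pochFactor b (suc n)) (poch∞ (shift (suc n) b)))
      ≈⟨ mul-assoc P (pochFactor b (suc n)) (poch∞ (shift (suc n) b)) ⟨
    mul (prod1 (suc n) (pochFactor b)) (poch∞ (shift (suc n) b)) ∎
    where
    open ≈-Reasoning
    P = prod1 n (pochFactor b)

  poch∞-≡[<]-one : ∀ k b → b ∈O[y^ k ] → poch∞ b ≡[< k ] one
  poch∞-≡[<]-one k b ob = ∏-≡[<]-one {h = pochFactor b} λ j →
    1-∈O (∈O-mono (ℕP.m≤n+m k (suc j)) (∈O-shift (suc j) ob))

  -- The identity Θ₀(-a, y) = (y; y)∞ (a y; y)∞ (𝓕 a - a)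

  invPoch : ℕ → FPS
  invPoch n = prod1 n (λ j → geom (y^ j))

  -- Wterm a n = yⁿ (a yⁿ; y)∞ / (y; y)ₙ
  Wterm : FPS → ℕ → FPS
  Wterm a n = shift n (mul (mul (invPoch n) (1- shift n a)) (poch∞ (shift n a)))

  W : FPS → FPS
  W a = ∑ (Wterm a)

  Wterm-locallyFinite : ∀ a → LocallyFinite (Wterm a)
  Wterm-locallyFinite a n = shift-∈O n _

  poch∞*Fterm≈Wterm : ∀ a i → mul (poch∞ a) (Fterm a (suc i)) ≈ Wterm a (suc i)
  poch∞*Fterm≈Wterm a i = begin
    mul (poch∞ a) (shift n (mul Q G))
      ≈⟨ mul-shiftʳ n (poch∞ a) (mul Q G) ⟩
    shift n (mul (poch∞ a) (mul Q G))
      ≈⟨ shift-cong n (mul-congʳ (mul Q G) (poch∞-split n a)) ⟩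
    shift n (mul (mul (mul P O) R) (mul Q G))
      ≈⟨ shift-cong n (solve 5 (λ p o r q g → ((p :* o) :* r) :* (q :* g) := (g :* p) :* ((q :* o) :* r))
                         ≈-refl P O R Q G) ⟩
    shift n (mul (mul G P) (mul (mul Q O) R))
      ≈⟨ shift-cong n (mul-congʳ (mul (mul Q O) R) (prod1-geom-inverse i (λ j → shift j a) (λ j → ∈O-mono (s≤s z≤n) (shift-∈O (suc j) a)))) ⟩
    shift n (mul one (mul (mul Q O) R))
      ≈⟨ shift-cong n (mul-identityˡ (mul (mul Q O) R)) ⟩
    Wterm a n ∎
    where
    open ≈-Reasoning
    n = suc i
    Q = invPoch n
    G = prod1 i (λ j → geom (shift j a))
    P = prod1 i (pochFactor a)
    O = 1- shift n a
    R = poch∞ (shift n a)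

  [𝓕a-a]*poch∞a≈Wa : ∀ a → mul (add (𝓕 a) (neg a)) (poch∞ a) ≈ W a
  [𝓕a-a]*poch∞a≈Wa a = begin
    mul (add (add one S) (neg a)) R
      ≈⟨ mul-congʳ R (solve 3 (λ s x o → (o :+ s) :- x := (o :- x) :+ s) ≈-refl S a one) ⟩
    mul (add (1- a) S) R
      ≈⟨ mul-distribʳ R (1- a) S ⟩
    add (mul (1- a) R) (mul S R)
      ≈⟨ add-cong (mul-congʳ R (mul-identityˡ (1- a))) (mul-comm R S) ⟨
    add (Wterm a 0) (mul R S)
      ≈⟨ add-congˡ (Wterm a 0) (mul-∑ R (λ i → ∈O-mono (ℕP.n≤1+n i) (shift-∈O (suc i) _))) ⟩
    add (Wterm a 0) (∑ (λ i → mul R (Fterm a (suc i))))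
      ≈⟨ add-congˡ (Wterm a 0) (∑-cong (poch∞*Fterm≈Wterm a)) ⟩
    add (Wterm a 0) (∑ (λ i → Wterm a (suc i)))
      ≈⟨ ∑-unfoldˡ (Wterm a) (Wterm-locallyFinite a) ⟨
    W a ∎
    where
    open ≈-Reasoning
    S = ∑ (λ i → Fterm a (suc i))
    R = poch∞ a

  Wterm-shift : ∀ a n → Wterm (shift 1 a) n ≈ shift n (mul (invPoch n) (poch∞ (shift n a)))
  Wterm-shift a n = shift-cong n (begin
    mul (mul Q (1- shift n (shift 1 a))) (poch∞ (shift n (shift 1 a)))
      ≈⟨ mul-cong (mul-congˡ Q (1-cong e)) (poch∞-cong e) ⟩
    mul (mul Q (1- shift 1 (shift n a))) (poch∞ (shift 1 (shift n a)))
      ≈⟨ mul-assoc Q (1- shift 1 (shift n a)) (poch∞ (shift 1 (shift n a))) ⟩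
    mul Q (mul (1- shift 1 (shift n a)) (poch∞ (shift 1 (shift n a))))
      ≈⟨ mul-congˡ Q (poch∞-unfold (shift n a)) ⟨
    mul Q (poch∞ (shift n a)) ∎)
    where
    open ≈-Reasoning
    Q = invPoch n
    e : shift n (shift 1 a) ≈ shift 1 (shift n a)
    e = ≈-trans (≈-sym (shift-suc n a)) (≈-sym (shift-shift 1 n a))

  Wterm-step₀ : ∀ a → add (Wterm a 0) (mul a (Wterm (shift 1 a) 0)) ≈ Wterm (shift 1 a) 0
  Wterm-step₀ a = begin
    add (Wterm a 0) (mul a (Wterm (shift 1 a) 0))
      ≈⟨ add-cong (mul-congʳ R (mul-identityˡ (1- a))) (mul-congˡ a Wterm₁≈R) ⟩
    add (mul (1- a) R) (mul a R)
      ≈⟨ solve 2 (λ a r → (con 1ℤ :- a) :* r :+ a :* r := r) ≈-refl a R ⟩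
    R
      ≈⟨ Wterm₁≈R ⟨
    Wterm (shift 1 a) 0 ∎
    where
    open ≈-Reasoning
    R = poch∞ a
    Wterm₁≈R : Wterm (shift 1 a) 0 ≈ R
    Wterm₁≈R = ≈-trans (Wterm-shift a 0) (mul-identityˡ R)

  Wterm-shift₂ : ∀ a i → mul (shift 1 a) (Wterm (shift 1 (shift 1 a)) i)
                       ≈ mul (mul (y^ suc i) a) (mul (invPoch i) (poch∞ (shift (suc i) a)))
  Wterm-shift₂ a i = begin
    mul a₁ (Wterm (shift 1 a₁) i)
      ≈⟨ mul-cong (shift≈y^* 1 a) (≈-trans (Wterm-shift a₁ i) (shift≈y^* i _)) ⟩
    mul (mul (y^ 1) a) (mul (y^ i) (mul Q (poch∞ (shift i a₁))))
      ≈⟨ mul-congˡ (mul (y^ 1) a) (mul-congˡ (y^ i) (mul-congˡ Q (poch∞-cong (≈-sym (shift-suc i a))))) ⟩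
    mul (mul (y^ 1) a) (mul (y^ i) (mul Q R))
      ≈⟨ solve 4 (λ x a y z → (x :* a) :* (y :* z) := (x :* y) :* a :* z) ≈-refl (y^ 1) a (y^ i) (mul Q R) ⟩
    mul (mul (mul (y^ 1) (y^ i)) a) (mul Q R)
      ≈⟨ mul-congʳ (mul Q R) (mul-congʳ a (y^-+ 1 i)) ⟩
    mul (mul (y^ suc i) a) (mul Q R) ∎
    where
    open ≈-Reasoning
    a₁ = shift 1 a
    Q  = invPoch i
    R  = poch∞ (shift (suc i) a)

  -- With M = yⁿ and 1 / (y; y)ₙ = Q g, where g = 1 / (1 - M), the step reduces to g (1 - M) = 1.
  Wterm-step : ∀ a i → add (Wterm a (suc i)) (mul a (Wterm (shift 1 a) (suc i)))
                     ≈ add (Wterm (shift 1 a) (suc i)) (mul (shift 1 a) (Wterm (shift 1 (shift 1 a)) i))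
  Wterm-step a i = begin
    add (Wterm a n) (mul a (Wterm a₁ n))
      ≈⟨ add-cong lhs₁ (mul-congˡ a rhs₁) ⟩
    add (mul M (mul (mul (mul Q g) (1- mul M a)) R)) (mul a (mul M (mul (mul Q g) R)))
      ≈⟨ solve 5 (λ m a q g r → m :* (((q :* g) :* (con 1ℤ :- m :* a)) :* r) :+ a :* (m :* ((q :* g) :* r))
                             := m :* ((q :* g) :* r) :+ (m :* a) :* (q :* r) :* (g :* (con 1ℤ :- m)))
                 ≈-refl M a Q g R ⟩
    add (mul M (mul (mul Q g) R)) (mul (mul (mul M a) (mul Q R)) (mul g (1- M)))
      ≈⟨ add-congˡ (mul M (mul (mul Q g) R))
           (≈-trans (mul-congˡ (mul (mul M a) (mul Q R)) (geom-inverse M (∈O-mono (s≤s z≤n) (shift-∈O n one))))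
                    (mul-identityʳ (mul (mul M a) (mul Q R)))) ⟩
    add (mul M (mul (mul Q g) R)) (mul (mul M a) (mul Q R))
      ≈⟨ add-cong rhs₁ (Wterm-shift₂ a i) ⟨
    add (Wterm a₁ n) (mul a₁ (Wterm (shift 1 a₁) i)) ∎
    where
    open ≈-Reasoning
    n  = suc i
    a₁ = shift 1 a
    M  = y^ n
    Q  = invPoch i
    g  = geom (y^ n)
    R  = poch∞ (shift n a)
    lhs₁ : Wterm a n ≈ mul M (mul (mul (mul Q g) (1- mul M a)) R)
    lhs₁ = ≈-trans (shift≈y^* n _) (mul-congˡ M (mul-congʳ R (mul-congˡ (mul Q g) (1-cong (shift≈y^* n a)))))
    rhs₁ : Wterm a₁ n ≈ mul M (mul (mul Q g) R)
    rhs₁ = ≈-trans (Wterm-shift a n) (shift≈y^* n _)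

  W⁺ : FPS → FPS
  W⁺ a = add (W a) (mul a (W (shift 1 a)))

  W⁺-shift : ∀ a → W⁺ a ≈ W⁺ (shift 1 a)
  W⁺-shift a = begin
    add (W a) (mul a (W a₁))
      ≈⟨ add-congˡ (W a) (mul-∑ a (Wterm-locallyFinite a₁)) ⟩
    add (W a) (∑ (λ n → mul a (Wterm a₁ n)))
      ≈⟨ ∑-add (Wterm a) (λ n → mul a (Wterm a₁ n)) ⟨
    ∑ T
      ≈⟨ ∑-unfoldˡ T (λ n → ∈O-add (Wterm-locallyFinite a n) (mul-∈Oˡ a (Wterm-locallyFinite a₁ n))) ⟩
    add (T 0) (∑ (λ i → T (suc i)))
      ≈⟨ add-cong (Wterm-step₀ a) (∑-cong (Wterm-step a)) ⟩
    add (Wterm a₁ 0) (∑ (λ i → add (Wterm a₁ (suc i)) (mul a₁ (Wterm a₂ i))))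
      ≈⟨ add-congˡ (Wterm a₁ 0) (∑-add (λ i → Wterm a₁ (suc i)) (λ i → mul a₁ (Wterm a₂ i))) ⟩
    add (Wterm a₁ 0) (add (∑ (λ i → Wterm a₁ (suc i))) (∑ (λ i → mul a₁ (Wterm a₂ i))))
      ≈⟨ +-assoc (Wterm a₁ 0) (∑ (λ i → Wterm a₁ (suc i))) (∑ (λ i → mul a₁ (Wterm a₂ i))) ⟨
    add (add (Wterm a₁ 0) (∑ (λ i → Wterm a₁ (suc i)))) (∑ (λ i → mul a₁ (Wterm a₂ i)))
      ≈⟨ add-cong (∑-unfoldˡ (Wterm a₁) (Wterm-locallyFinite a₁)) (mul-∑ a₁ (Wterm-locallyFinite a₂)) ⟨
    add (W a₁) (mul a₁ (W a₂)) ∎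
    where
    open ≈-Reasoning
    open CommutativeRing FPS-commutativeRing using (+-assoc)
    a₁ = shift 1 a
    a₂ = shift 1 a₁
    T  = λ n → add (Wterm a n) (mul a (Wterm a₁ n))

  Wterm-cong : ∀ {a b} → a ≈ b → ∀ n → Wterm a n ≈ Wterm b n
  Wterm-cong e n =
    shift-cong n (mul-cong (mul-congˡ (invPoch n) (1-cong (shift-cong n e))) (poch∞-cong (shift-cong n e)))

  W-cong : ∀ {a b} → a ≈ b → W a ≈ W b
  W-cong e = ∑-cong (Wterm-cong e)

  W⁺-cong : ∀ {a b} → a ≈ b → W⁺ a ≈ W⁺ b
  W⁺-cong e = add-cong (W-cong e) (mul-cong e (W-cong (shift-cong 1 e)))

  W⁺-shiftⁿ : ∀ K a → W⁺ a ≈ W⁺ (shift K a)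
  W⁺-shiftⁿ zero    a = ≈-refl
  W⁺-shiftⁿ (suc K) a =
    ≈-trans (W⁺-shiftⁿ K a) (≈-trans (W⁺-shift (shift K a)) (W⁺-cong (shift-shift 1 K a)))

  eulerSeries : FPS
  eulerSeries = ∑ (λ n → shift n (invPoch n))

  W-≡[<]-eulerSeries : ∀ K b → b ∈O[y^ K ] → W b ≡[< K ] eulerSeries
  W-≡[<]-eulerSeries K b ob = ∑-≡[<] λ n →
    ≡[<]-mono (ℕP.m≤n+m K n) (≡[<]-shift n (≡[<]-trans
      (≡[<]-mul (≡[<]-mul {f = invPoch n} ≡[<]-refl (1-∈O (bₙ n))) (poch∞-≡[<]-one K (shift n b) (bₙ n)))
      (≈⇒≡[<] (≈-trans (mul-identityʳ (mul (invPoch n) one)) (mul-identityʳ (invPoch n))))))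
    where
    bₙ : ∀ n → shift n b ∈O[y^ K ]
    bₙ n = ∈O-mono (ℕP.m≤n+m K n) (∈O-shift n ob)

  W⁺-≡[<]-eulerSeries : ∀ K b → b ∈O[y^ K ] → W⁺ b ≡[< K ] eulerSeries
  W⁺-≡[<]-eulerSeries K b ob n n<K =
    trans (cong₂ _+_ (W-≡[<]-eulerSeries K b ob n n<K) (mul-∈Oʳ (W (shift 1 b)) ob n n<K))
          (ℤP.+-identityʳ (eulerSeries n))

  -- W⁺ a = W⁺ (y^(m+1) a), and the latter agrees with eulerSeries up to y^m.
  W⁺≈eulerSeries : ∀ a → W⁺ a ≈ eulerSeries
  W⁺≈eulerSeries a = ≡[<]⇒≈ λ m → ≡[<]-trans (≈⇒≡[<] (W⁺-shiftⁿ (suc m) a))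
    (W⁺-≡[<]-eulerSeries (suc m) (shift (suc m) a) (shift-∈O (suc m) a))

  eulerPartial : ℕ → FPS
  eulerPartial N m = sumTo N (λ n → shift n (invPoch n) m)

  eulerPartial≈invPoch : ∀ N → eulerPartial N ≈ invPoch N
  eulerPartial≈invPoch zero    = ≈-refl
  eulerPartial≈invPoch (suc N) = begin
    add (eulerPartial N) (shift (suc N) (invPoch (suc N)))
      ≈⟨ add-cong (eulerPartial≈invPoch N) (shift≈y^* (suc N) (invPoch (suc N))) ⟩
    add Q (mul M (mul Q g))
      ≈⟨ solve 3 (λ q m g → q :+ m :* (q :* g) := (q :* g) :+ q :* (con 1ℤ :- g :* (con 1ℤ :- m))) ≈-refl Q M g ⟩
    add (mul Q g) (mul Q (1- mul g (1- M)))
      ≈⟨ add-congˡ (mul Q g) (mul-congˡ Q (1-cong (geom-inverse M (∈O-mono (s≤s z≤n) (shift-∈O (suc N) one))))) ⟩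
    add (mul Q g) (mul Q (1- one))
      ≈⟨ solve 2 (λ q g → (q :* g) :+ q :* (con 1ℤ :- con 1ℤ) := q :* g) ≈-refl Q g ⟩
    invPoch (suc N) ∎
    where
    open ≈-Reasoning
    Q = invPoch N
    M = y^ suc N
    g = geom M

  φ : FPS
  φ = poch∞ one

  φ*eulerSeries≈1 : mul φ eulerSeries ≈ one
  φ*eulerSeries≈1 = ≡[<]⇒≈ λ m → ≡[<]-trans
    (≡[<]-mul (∏-≡[<]-prod1 (λ j → 1-∈O (shift-∈O j one)) m)
              (λ n n<1+m → sym (∑-extend (λ n → shift-∈O n (invPoch n)) (ℕP.≤-pred n<1+m))))
    (≈⇒≡[<] (begin
      mul (prod1 m (pochFactor one)) (eulerPartial m)  ≈⟨ mul-congˡ (prod1 m (pochFactor one)) (eulerPartial≈invPoch m) ⟩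
      mul (prod1 m (pochFactor one)) (invPoch m)       ≈⟨ mul-comm (prod1 m (pochFactor one)) (invPoch m) ⟩
      mul (invPoch m) (prod1 m (pochFactor one))
        ≈⟨ prod1-geom-inverse m (λ j → shift j one) (λ j → ∈O-mono (s≤s z≤n) (shift-∈O (suc j) one)) ⟩
      one ∎))
    where open ≈-Reasoning

  X : FPS → FPS
  X a = mul φ (W a)

  X-cong : ∀ {a b} → a ≈ b → X a ≈ X b
  X-cong e = mul-congˡ φ (W-cong e)

  X-recursion : ∀ a → X a ≈ 1- mul a (X (shift 1 a))
  X-recursion a = begin
    mul φ (W a)
      ≈⟨ mul-congˡ φ (solve 3 (λ w a w₁ → w := (w :+ a :* w₁) :- a :* w₁) ≈-refl (W a) a W₁) ⟩
    mul φ (add (W⁺ a) (neg (mul a W₁)))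
      ≈⟨ mul-congˡ φ (add-congʳ (neg (mul a W₁)) (W⁺≈eulerSeries a)) ⟩
    mul φ (add eulerSeries (neg (mul a W₁)))
      ≈⟨ solve 4 (λ p e a w₁ → p :* (e :- a :* w₁) := p :* e :- a :* (p :* w₁)) ≈-refl φ eulerSeries a W₁ ⟩
    add (mul φ eulerSeries) (neg (mul a (X (shift 1 a))))
      ≈⟨ add-cong φ*eulerSeries≈1 ≈-refl ⟩
    1- mul a (X (shift 1 a)) ∎
    where
    open ≈-Reasoning
    W₁ = W (shift 1 a)

  choose2 : ℕ → ℕ
  choose2 zero    = 0
  choose2 (suc k) = choose2 k ℕ.+ k

  ⌊n*[n∸1]/2⌋≡choose2 : ∀ n → ⌊ n ℕ.* (n ∸ 1) /2⌋ ≡ choose2 n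
  ⌊n*[n∸1]/2⌋≡choose2 n = trans (cong ⌊_/2⌋ (sym (double n))) (sym (ℕP.n≡⌊n+n/2⌋ (choose2 n)))
    where
    double : ∀ n → choose2 n ℕ.+ choose2 n ≡ n ℕ.* (n ∸ 1)
    double zero          = refl
    double (suc zero)    = refl
    double (suc (suc k)) = begin
      (c ℕ.+ suc k) ℕ.+ (c ℕ.+ suc k)  ≡⟨ regroup c (suc k) ⟩
      (c ℕ.+ c) ℕ.+ (suc k ℕ.+ suc k)  ≡⟨ cong (ℕ._+ (suc k ℕ.+ suc k)) (double (suc k)) ⟩
      suc k ℕ.* k ℕ.+ (suc k ℕ.+ suc k) ≡⟨ expand k ⟩
      suc (suc k) ℕ.* suc k            ∎
      where
      open ≡-Reasoning
      c = choose2 (suc k)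
      regroup : ∀ t s → (t ℕ.+ s) ℕ.+ (t ℕ.+ s) ≡ (t ℕ.+ t) ℕ.+ (s ℕ.+ s)
      regroup = ℕSolver.solve-∀
      expand : ∀ k → suc k ℕ.* k ℕ.+ (suc k ℕ.+ suc k) ≡ suc (suc k) ℕ.* suc k
      expand = ℕSolver.solve-∀

  m<choose2[2+m] : ∀ m → m ℕ.< choose2 (suc (suc m))
  m<choose2[2+m] m = ℕP.<-≤-trans (ℕP.n<1+n m) (ℕP.m≤n+m (suc m) (choose2 (suc m)))

  θterm : FPS → ℕ → FPS
  θterm a k = shift (choose2 k) (pow (neg a) k)

  θ< : ℕ → FPS → FPS
  θ< K a m = sumBelow K (λ k → θterm a k m)

  pow-neg-shift : ∀ K a → pow (neg (shift 1 a)) K ≈ shift K (pow (neg a) K)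
  pow-neg-shift zero    a = ≈-refl
  pow-neg-shift (suc K) a = begin
    mul (neg (shift 1 a)) (pow (neg (shift 1 a)) K)
      ≈⟨ mul-cong (shift-neg 1 a) (pow-neg-shift K a) ⟩
    mul (shift 1 (neg a)) (shift K P)
      ≈⟨ mul-shiftˡ 1 (neg a) (shift K P) ⟩
    shift 1 (mul (neg a) (shift K P))
      ≈⟨ shift-cong 1 (mul-shiftʳ K (neg a) P) ⟩
    shift 1 (shift K (mul (neg a) P))
      ≈⟨ shift-shift 1 K (mul (neg a) P) ⟩
    shift (suc K) (pow (neg a) (suc K)) ∎
    where
    open ≈-Reasoning
    P = pow (neg a) K

  θterm-suc : ∀ K a → θterm a (suc K) ≈ mul (neg a) (θterm (shift 1 a) K)
  θterm-suc K a = ≈-sym (begin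
    mul (neg a) (shift (choose2 K) (pow (neg (shift 1 a)) K))
      ≈⟨ mul-shiftʳ (choose2 K) (neg a) (pow (neg (shift 1 a)) K) ⟩
    shift (choose2 K) (mul (neg a) (pow (neg (shift 1 a)) K))
      ≈⟨ shift-cong (choose2 K) (mul-congˡ (neg a) (pow-neg-shift K a)) ⟩
    shift (choose2 K) (mul (neg a) (shift K (pow (neg a) K)))
      ≈⟨ shift-cong (choose2 K) (mul-shiftʳ K (neg a) (pow (neg a) K)) ⟩
    shift (choose2 K) (shift K (pow (neg a) (suc K)))
      ≈⟨ shift-shift (choose2 K) K (pow (neg a) (suc K)) ⟩
    θterm a (suc K) ∎)
    where open ≈-Reasoning

  θ<-suc : ∀ K a → θ< (suc K) a ≈ 1- mul a (θ< K (shift 1 a))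
  θ<-suc zero    a = mk≈ λ n → trans (ℤP.+-identityˡ (one n)) (sym (trans
    (cong (one n +_) (cong -_ (at (mul-zeroʳ a) n))) (ℤP.+-identityʳ (one n))))
  θ<-suc (suc K) a = begin
    add (θ< (suc K) a) (θterm a (suc K))
      ≈⟨ add-cong (θ<-suc K a) (θterm-suc K a) ⟩
    add (1- mul a θ) (mul (neg a) t)
      ≈⟨ solve 3 (λ a θ t → (con 1ℤ :- a :* θ) :+ (:- a) :* t := con 1ℤ :- a :* (θ :+ t)) ≈-refl a θ t ⟩
    1- mul a (θ< (suc K) (shift 1 a)) ∎
    where
    open ≈-Reasoning
    θ = θ< K (shift 1 a)
    t = θterm (shift 1 a) K

  X-expansion : ∀ K a → X a ≈ add (θ< K a) (shift (choose2 K) (mul (pow (neg a) K) (X (shift K a))))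
  X-expansion zero    a = ≈-sym (≈-trans (mk≈ λ n → ℤP.+-identityˡ _) (mul-identityˡ (X a)))
  X-expansion (suc K) a = begin
    X a
      ≈⟨ X-recursion a ⟩
    1- mul a (X a₁)
      ≈⟨ add-congˡ one (neg-cong (mul-congˡ a (X-expansion K a₁))) ⟩
    1- mul a (add (θ< K a₁) rest)
      ≈⟨ solve 3 (λ a θ r → con 1ℤ :- a :* (θ :+ r) := (con 1ℤ :- a :* θ) :+ (:- a) :* r) ≈-refl a (θ< K a₁) rest ⟩
    add (1- mul a (θ< K a₁)) (mul (neg a) rest)
      ≈⟨ add-cong (θ<-suc K a) rest-step ⟨
    add (θ< (suc K) a) (shift (choose2 (suc K)) (mul (pow (neg a) (suc K)) (X (shift (suc K) a)))) ∎
    where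
    open ≈-Reasoning
    a₁   = shift 1 a
    P    = pow (neg a) K
    Y    = X (shift K a₁)
    rest = shift (choose2 K) (mul (pow (neg a₁) K) Y)
    rest-step : shift (choose2 (suc K)) (mul (pow (neg a) (suc K)) (X (shift (suc K) a))) ≈ mul (neg a) rest
    rest-step = ≈-sym (begin
      mul (neg a) (shift (choose2 K) (mul (pow (neg a₁) K) Y))
        ≈⟨ mul-shiftʳ (choose2 K) (neg a) (mul (pow (neg a₁) K) Y) ⟩
      shift (choose2 K) (mul (neg a) (mul (pow (neg a₁) K) Y))
        ≈⟨ shift-cong (choose2 K) (mul-congˡ (neg a) (mul-congʳ Y (pow-neg-shift K a))) ⟩
      shift (choose2 K) (mul (neg a) (mul (shift K P) Y))
        ≈⟨ shift-cong (choose2 K) (mul-congˡ (neg a) (mul-shiftˡ K P Y)) ⟩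
      shift (choose2 K) (mul (neg a) (shift K (mul P Y)))
        ≈⟨ shift-cong (choose2 K) (mul-shiftʳ K (neg a) (mul P Y)) ⟩
      shift (choose2 K) (shift K (mul (neg a) (mul P Y)))
        ≈⟨ shift-shift (choose2 K) K (mul (neg a) (mul P Y)) ⟩
      shift (choose2 (suc K)) (mul (neg a) (mul P Y))
        ≈⟨ shift-cong (choose2 (suc K)) (mul-assoc (neg a) P Y) ⟨
      shift (choose2 (suc K)) (mul (pow (neg a) (suc K)) Y)
        ≈⟨ shift-cong (choose2 (suc K)) (mul-congˡ (pow (neg a) (suc K)) (X-cong (shift-suc K a))) ⟨
      shift (choose2 (suc K)) (mul (pow (neg a) (suc K)) (X (shift (suc K) a))) ∎)

  -- The remainder after K terms lies in O(y^(K(K-1)/2)), so m < choose2 (m + 2) terms suffice for [yᵐ].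
  X≈Theta0Neg : ∀ a → X a ≈ Theta0Neg a
  X≈Theta0Neg a = mk≈ coeff
    where
    open ≡-Reasoning
    coeff : ∀ m → X a m ≡ Theta0Neg a m
    coeff m = begin
      X a m
        ≡⟨ at (X-expansion K a) m ⟩
      θ< K a m + shift (choose2 K) (mul (pow (neg a) K) (X (shift K a))) m
        ≡⟨ cong (θ< K a m +_) (shift-∈O (choose2 K) _ m (m<choose2[2+m] m)) ⟩
      θ< K a m + 0ℤ
        ≡⟨ ℤP.+-identityʳ (θ< K a m) ⟩
      θ< K a m
        ≡⟨ sumTo≡sumBelow (suc m) (λ k → θterm a k m) ⟨
      sumTo (suc m) (λ k → θterm a k m)
        ≡⟨ sumTo-cong (suc m) (λ k _ → cong (λ e → shift e (pow (neg a) k) m) (⌊n*[n∸1]/2⌋≡choose2 k)) ⟨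
      Theta0Neg a m ∎
      where K = suc (suc m)

  Theta0Neg≈[𝓕a-a]*φ*poch∞a : ∀ a → Theta0Neg a ≈ mul (add (𝓕 a) (neg a)) (mul φ (poch∞ a))
  Theta0Neg≈[𝓕a-a]*φ*poch∞a a = ≈-sym (begin
    mul D (mul φ (poch∞ a))  ≈⟨ solve 3 (λ d p r → d :* (p :* r) := p :* (d :* r)) ≈-refl D φ (poch∞ a) ⟩
    mul φ (mul D (poch∞ a))  ≈⟨ mul-congˡ φ ([𝓕a-a]*poch∞a≈Wa a) ⟩
    X a                      ≈⟨ X≈Theta0Neg a ⟩
    Theta0Neg a              ∎)
    where
    open ≈-Reasoning
    D = add (𝓕 a) (neg a)

  mul-cancel-unit : ∀ D P → P 0 ≡ 1ℤ → mul D P ≈ zeroₛ → D ≈ zeroₛ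
  mul-cancel-unit D P P₀≡1 DP≈0 = mk≈ λ n → vanish n n ℕP.≤-refl
    where
    diagonal : ∀ n → D n ≡ D n * P (n ∸ n)
    diagonal n = sym (trans (cong (λ k → D n * P k) (ℕP.n∸n≡0 n))
                            (trans (cong (D n *_) P₀≡1) (ℤP.*-identityʳ (D n))))
    vanish : ∀ n i → i ℕ.≤ n → D i ≡ 0ℤ
    vanish zero    zero z≤n = trans (diagonal 0) (at DP≈0 0)
    vanish (suc n) i i≤1+n with ℕP.m≤n⇒m<n∨m≡n i≤1+n
    ... | inj₁ i<1+n = vanish n i (ℕP.≤-pred i<1+n)
    ... | inj₂ refl  = begin
      D (suc n)
        ≡⟨ diagonal (suc n) ⟩
      D (suc n) * P (n ∸ n)
        ≡⟨ ℤP.+-identityˡ _ ⟨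
      0ℤ + D (suc n) * P (n ∸ n)
        ≡⟨ cong (_+ D (suc n) * P (n ∸ n)) (sumTo-zero n λ j j≤n →
             trans (cong (_* P (suc n ∸ j)) (vanish n j j≤n)) (ℤP.*-zeroˡ (P (suc n ∸ j)))) ⟨
      mul D P (suc n)
        ≡⟨ at DP≈0 (suc n) ⟩
      0ℤ ∎
      where open ≡-Reasoning

  𝓕-fixedPoint : ∀ ξ → (∀ m → Theta0Neg ξ m ≡ 0ℤ) → 𝓕 ξ ≈ ξ
  𝓕-fixedPoint ξ Θ≡0 = begin
    𝓕 ξ                           ≈⟨ solve 2 (λ f x → f := (f :- x) :+ x) ≈-refl (𝓕 ξ) ξ ⟩
    add (add (𝓕 ξ) (neg ξ)) ξ    ≈⟨ add-congʳ ξ 𝓕ξ-ξ≈0 ⟩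
    add zeroₛ ξ                   ≈⟨ mk≈ (λ n → ℤP.+-identityˡ (ξ n)) ⟩
    ξ                             ∎
    where
    open ≈-Reasoning
    𝓕ξ-ξ≈0 : add (𝓕 ξ) (neg ξ) ≈ zeroₛ
    𝓕ξ-ξ≈0 = mul-cancel-unit (add (𝓕 ξ) (neg ξ)) (mul φ (poch∞ ξ)) refl
      (≈-trans (≈-sym (Theta0Neg≈[𝓕a-a]*φ*poch∞a ξ)) (mk≈ Θ≡0))

  -- Monotonicity, positivity and contraction of 𝓕

  *-mono-≤-nonNeg : ∀ {a a′ b b′} → 0ℤ ℤ.≤ a → a ℤ.≤ a′ → 0ℤ ℤ.≤ b → b ℤ.≤ b′ → a * b ℤ.≤ a′ * b′
  *-mono-≤-nonNeg {ℤ.pos m} {ℤ.pos m′} {ℤ.pos k} {ℤ.pos k′} _ (ℤ.+≤+ m≤m′) _ (ℤ.+≤+ k≤k′) =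
    subst₂ ℤ._≤_ (ℤP.pos-* m k) (ℤP.pos-* m′ k′) (ℤ.+≤+ (ℕP.*-mono-≤ m≤m′ k≤k′))

  sumTo-mono : ∀ n {f g} → (∀ i → i ℕ.≤ n → f i ℤ.≤ g i) → sumTo n f ℤ.≤ sumTo n g
  sumTo-mono zero    f≤g = f≤g 0 z≤n
  sumTo-mono (suc n) f≤g = ℤP.+-mono-≤ (sumTo-mono n (λ i i≤n → f≤g i (ℕP.m≤n⇒m≤1+n i≤n))) (f≤g (suc n) ℕP.≤-refl)

  sumTo-nonNeg : ∀ n {f} → (∀ i → 0ℤ ℤ.≤ f i) → 0ℤ ℤ.≤ sumTo n f
  sumTo-nonNeg zero    f≥0 = f≥0 0
  sumTo-nonNeg (suc n) f≥0 = ℤP.+-mono-≤ (sumTo-nonNeg n f≥0) (f≥0 (suc n))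

  term≤sumTo : ∀ n {f} → (∀ i → 0ℤ ℤ.≤ f i) → ∀ k → k ℕ.≤ n → f k ℤ.≤ sumTo n f
  term≤sumTo zero    f≥0 zero z≤n = ℤP.≤-refl
  term≤sumTo (suc n) {f} f≥0 k k≤1+n with ℕP.m≤n⇒m<n∨m≡n k≤1+n
  ... | inj₁ k<1+n = subst (ℤ._≤ sumTo n f + f (suc n)) (ℤP.+-identityʳ (f k))
                       (ℤP.+-mono-≤ (term≤sumTo n f≥0 k (ℕP.≤-pred k<1+n)) (f≥0 (suc n)))
  ... | inj₂ refl  = subst (ℤ._≤ sumTo n f + f (suc n)) (ℤP.+-identityˡ (f (suc n)))
                       (ℤP.+-mono-≤ (sumTo-nonNeg n f≥0) ℤP.≤-refl)

  one-nonNeg : zeroₛ ⪯ one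
  one-nonNeg zero    = ℤ.+≤+ z≤n
  one-nonNeg (suc n) = ℤ.+≤+ z≤n

  mul-nonNeg : ∀ {f g} → zeroₛ ⪯ f → zeroₛ ⪯ g → zeroₛ ⪯ mul f g
  mul-nonNeg {f} {g} f≥0 g≥0 n = sumTo-nonNeg n λ i →
    subst (ℤ._≤ f i * g (n ∸ i)) (ℤP.*-zeroˡ 0ℤ) (*-mono-≤-nonNeg ℤP.≤-refl (f≥0 i) ℤP.≤-refl (g≥0 (n ∸ i)))

  mul-mono : ∀ {f f′ g g′} → zeroₛ ⪯ f → zeroₛ ⪯ g → f ⪯ f′ → g ⪯ g′ → mul f g ⪯ mul f′ g′
  mul-mono f≥0 g≥0 f⪯f′ g⪯g′ n =
    sumTo-mono n (λ i _ → *-mono-≤-nonNeg (f≥0 i) (f⪯f′ i) (g≥0 (n ∸ i)) (g⪯g′ (n ∸ i)))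

  shift-nonNeg : ∀ k {f} → zeroₛ ⪯ f → zeroₛ ⪯ shift k f
  shift-nonNeg zero    f≥0         = f≥0
  shift-nonNeg (suc k) f≥0 zero    = ℤP.≤-refl
  shift-nonNeg (suc k) f≥0 (suc n) = shift-nonNeg k f≥0 n

  shift-mono : ∀ k {f g} → f ⪯ g → shift k f ⪯ shift k g
  shift-mono zero    f⪯g         = f⪯g
  shift-mono (suc k) f⪯g zero    = ℤP.≤-refl
  shift-mono (suc k) f⪯g (suc n) = shift-mono k f⪯g n

  pow-nonNeg : ∀ {u} → zeroₛ ⪯ u → ∀ k → zeroₛ ⪯ pow u k
  pow-nonNeg u≥0 zero    = one-nonNeg
  pow-nonNeg u≥0 (suc k) = mul-nonNeg u≥0 (pow-nonNeg u≥0 k)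

  pow-mono : ∀ {u v} → zeroₛ ⪯ u → u ⪯ v → ∀ k → pow u k ⪯ pow v k
  pow-mono u≥0 u⪯v zero    n = ℤP.≤-refl
  pow-mono u≥0 u⪯v (suc k)   = mul-mono u≥0 (pow-nonNeg u≥0 k) u⪯v (pow-mono u≥0 u⪯v k)

  geom-nonNeg : ∀ {u} → zeroₛ ⪯ u → zeroₛ ⪯ geom u
  geom-nonNeg u≥0 n = sumTo-nonNeg n (λ k → pow-nonNeg u≥0 k n)

  geom-mono : ∀ {u v} → zeroₛ ⪯ u → u ⪯ v → geom u ⪯ geom v
  geom-mono u≥0 u⪯v n = sumTo-mono n (λ k _ → pow-mono u≥0 u⪯v k n)

  prod1-nonNeg : ∀ n {h} → (∀ j → zeroₛ ⪯ h j) → zeroₛ ⪯ prod1 n h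
  prod1-nonNeg zero    h≥0 = one-nonNeg
  prod1-nonNeg (suc n) h≥0 = mul-nonNeg (prod1-nonNeg n h≥0) (h≥0 (suc n))

  prod1-mono : ∀ n {h h′} → (∀ j → zeroₛ ⪯ h j) → (∀ j → h j ⪯ h′ j) → prod1 n h ⪯ prod1 n h′
  prod1-mono zero    h≥0 h⪯h′ m = ℤP.≤-refl
  prod1-mono (suc n) h≥0 h⪯h′   = mul-mono (prod1-nonNeg n h≥0) (h≥0 (suc n)) (prod1-mono n h≥0 h⪯h′) (h⪯h′ (suc n))

  invPoch-nonNeg : ∀ n → zeroₛ ⪯ invPoch n
  invPoch-nonNeg n = prod1-nonNeg n (λ j → geom-nonNeg (shift-nonNeg j one-nonNeg))

  Fterm-nonNeg : ∀ {ξ} → zeroₛ ⪯ ξ → ∀ n → zeroₛ ⪯ Fterm ξ n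
  Fterm-nonNeg ξ≥0 n = shift-nonNeg n (mul-nonNeg (invPoch-nonNeg n)
    (prod1-nonNeg (n ∸ 1) (λ j → geom-nonNeg (shift-nonNeg j ξ≥0))))

  Fterm-mono : ∀ {ξ η} → zeroₛ ⪯ ξ → ξ ⪯ η → ∀ n → Fterm ξ n ⪯ Fterm η n
  Fterm-mono ξ≥0 ξ⪯η n = shift-mono n (mul-mono (invPoch-nonNeg n)
    (prod1-nonNeg (n ∸ 1) (λ j → geom-nonNeg (shift-nonNeg j ξ≥0))) (λ _ → ℤP.≤-refl)
    (prod1-mono (n ∸ 1) (λ j → geom-nonNeg (shift-nonNeg j ξ≥0)) (λ j → geom-mono (shift-nonNeg j ξ≥0) (shift-mono j ξ⪯η))))

  𝓕-mono : ∀ {ξ η} → zeroₛ ⪯ ξ → ξ ⪯ η → 𝓕 ξ ⪯ 𝓕 η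
  𝓕-mono ξ≥0 ξ⪯η m = ℤP.+-monoʳ-≤ (one m) (sumTo-mono m (λ i _ → Fterm-mono ξ≥0 ξ⪯η (suc i) m))

  one⪯𝓕 : ∀ {ξ} → zeroₛ ⪯ ξ → one ⪯ 𝓕 ξ
  one⪯𝓕 ξ≥0 m = subst (ℤ._≤ 𝓕 _ m) (ℤP.+-identityʳ (one m))
    (ℤP.+-monoʳ-≤ (one m) (sumTo-nonNeg m (λ i → Fterm-nonNeg ξ≥0 (suc i) m)))

  Fterm-diagonal : ∀ ξ n → Fterm ξ n n ≡ 1ℤ
  Fterm-diagonal ξ n = trans (shift-diagonal n _) (cong₂ _*_ (prod1₀ n _ (λ _ → refl)) (prod1₀ (n ∸ 1) _ (λ _ → refl)))
    where
    prod1₀ : ∀ n h → (∀ j → h j 0 ≡ 1ℤ) → prod1 n h 0 ≡ 1ℤ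
    prod1₀ zero    h h₀≡1 = refl
    prod1₀ (suc n) h h₀≡1 = cong₂ _*_ (prod1₀ n h h₀≡1) (h₀≡1 (suc n))

  -- The summand y^(m+1) / ... of 𝓕 ξ contributes 1 to [y^(m+1)].
  1≤𝓕 : ∀ {ξ} → zeroₛ ⪯ ξ → ∀ n → 1ℤ ℤ.≤ 𝓕 ξ n
  1≤𝓕 ξ≥0 zero    = one⪯𝓕 ξ≥0 zero
  1≤𝓕 {ξ} ξ≥0 (suc m) = subst (ℤ._≤ 𝓕 ξ (suc m)) (trans (ℤP.+-identityˡ _) (Fterm-diagonal ξ (suc m)))
    (ℤP.+-monoʳ-≤ 0ℤ (term≤sumTo (suc m) (λ i → Fterm-nonNeg ξ≥0 (suc i) (suc m)) m (ℕP.n≤1+n m)))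

  pow-≡[<] : ∀ {k u v} → u ≡[< k ] v → ∀ j → pow u j ≡[< k ] pow v j
  pow-≡[<] a zero    = ≡[<]-refl
  pow-≡[<] a (suc j) = ≡[<]-mul a (pow-≡[<] a j)

  geom-≡[<] : ∀ {k u v} → u ≡[< k ] v → geom u ≡[< k ] geom v
  geom-≡[<] a n n<k = sumTo-cong n (λ j _ → pow-≡[<] a j n n<k)

  -- In Fterm ξ (i + 2) = y^(i+2) ⋯ / ((1 - y ξ) ⋯), ξ only enters multiplied by y; Fterm ξ 1 does not involve ξ.
  Fterm-≡[<] : ∀ k {ξ η} → ξ ≡[< k ] η → ∀ i → Fterm ξ (suc i) ≡[< 3 ℕ.+ k ] Fterm η (suc i)
  Fterm-≡[<] k a zero          = ≡[<]-refl
  Fterm-≡[<] k {ξ} {η} a (suc i) =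
    ≡[<]-mono (ℕP.+-monoˡ-≤ (suc k) (s≤s (s≤s (z≤n {i})))) (≡[<]-shift (suc (suc i))
      (≡[<]-mul {f = invPoch (suc (suc i))} ≡[<]-refl
        (prod1-≡[<] (suc i) {h = λ j → geom (shift j ξ)} {λ j → geom (shift j η)} λ j →
          geom-≡[<] (≡[<]-mono (ℕP.+-monoˡ-≤ k (s≤s (z≤n {j}))) (≡[<]-shift (suc j) a)))))

  𝓕-≡[<] : ∀ k {ξ η} → ξ ≡[< k ] η → 𝓕 ξ ≡[< 3 ℕ.+ k ] 𝓕 η
  𝓕-≡[<] k a = ≡[<]-add {f = one} ≡[<]-refl (∑-≡[<] (Fterm-≡[<] k a))

  iterF-nonNeg : ∀ k → zeroₛ ⪯ iterF k
  iterF-nonNeg zero      = one-nonNeg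
  iterF-nonNeg (suc k) n = ℤP.≤-trans (one-nonNeg n) (one⪯𝓕 (iterF-nonNeg k) n)

  iterF-increasing : ∀ k → iterF k ⪯ iterF (suc k)
  iterF-increasing zero    = one⪯𝓕 one-nonNeg
  iterF-increasing (suc k) = 𝓕-mono (iterF-nonNeg k) (iterF-increasing k)

  iterF-mono : ∀ {j k} → j ℕ.≤ k → iterF j ⪯ iterF k
  iterF-mono {j} j≤k = go (ℕP.≤⇒≤′ j≤k)
    where
    go : ∀ {k} → j ℕ.≤′ k → iterF j ⪯ iterF k
    go ℕ.≤′-refl         n = ℤP.≤-refl
    go (ℕ.≤′-step {k} p) n = ℤP.≤-trans (go p n) (iterF-increasing k n)

  n<3k+1 : ∀ {n k} → n ℕ.≤ k → n ℕ.< 3 ℕ.* k ℕ.+ 1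
  n<3k+1 {n} {k} n≤k = subst (suc n ℕ.≤_) (ℕP.+-comm 1 (3 ℕ.* k)) (s≤s (ℕP.≤-trans n≤k (ℕP.m≤n*m k 3)))

  module _ (ξ₀ : FPS) (Θ≡0 : ∀ m → Theta0Neg ξ₀ m ≡ 0ℤ) where

    iterF-≡[<]-root : ∀ k → iterF k ≡[< 3 ℕ.* k ℕ.+ 1 ] ξ₀
    iterF-≡[<]-root zero    zero    _          = at (𝓕-fixedPoint ξ₀ Θ≡0) 0
    iterF-≡[<]-root zero    (suc n) (s≤s ())
    iterF-≡[<]-root (suc k) = ≡[<]-mono (ℕP.≤-reflexive (3[1+k]+1 k))
      (≡[<]-trans (𝓕-≡[<] (3 ℕ.* k ℕ.+ 1) (iterF-≡[<]-root k)) (≈⇒≡[<] (𝓕-fixedPoint ξ₀ Θ≡0)))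
      where
      3[1+k]+1 : ∀ k → 3 ℕ.* suc k ℕ.+ 1 ≡ 3 ℕ.+ (3 ℕ.* k ℕ.+ 1)
      3[1+k]+1 = ℕSolver.solve-∀

    -- ξ₀⁽ᵏ⁾ ⪯ ξ₀⁽ᵏ⁺ⁿ⁾, whose coefficient of yⁿ is already ξ₀ n.
    iterF⪯root : ∀ k → iterF k ⪯ ξ₀
    iterF⪯root k n = subst (iterF k n ℤ.≤_) (iterF-≡[<]-root (k ℕ.+ n) n (n<3k+1 (ℕP.m≤n+m n k)))
      (iterF-mono (ℕP.m≤m+n k n) n)

    root-positive : ∀ n → 0ℤ ℤ.< ξ₀ n
    root-positive n = subst (0ℤ ℤ.<_) (iterF-≡[<]-root (suc n) n (n<3k+1 (ℕP.n≤1+n n)))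
      (ℤP.<-≤-trans (ℤ.+<+ (s≤s z≤n)) (1≤𝓕 (iterF-nonNeg n) n))

open import Data.Nat using (ℕ; suc; _<_; _≤_; _+_; _*_)
open import Data.Integer using (0ℤ) renaming (_<_ to _<ℤ_)
open import Data.Product using (_×_; ∃; _,_)
open import Relation.Binary.PropositionalEquality using (_≡_)

proposition3p1 : (ξ₀ : FPS) → (∀ m → Theta0Neg ξ₀ m ≡ 0ℤ) →
    ((k : ℕ) → iterF k ⪯ iterF (suc k)) ×
    ((k : ℕ) → iterF k ⪯ ξ₀) ×
    ((k n : ℕ) → n < 3 * k + 1 → iterF k n ≡ ξ₀ n) ×
    ((n : ℕ) → ∃ λ K → (k : ℕ) → K ≤ k → iterF k n ≡ ξ₀ n) ×
    ((n : ℕ) → 0ℤ <ℤ ξ₀ n)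
proposition3p1 ξ₀ Θ≡0 =
  iterF-increasing ,
  iterF⪯root ξ₀ Θ≡0 ,
  iterF-≡[<]-root ξ₀ Θ≡0 ,
  (λ n → n , λ k n≤k → iterF-≡[<]-root ξ₀ Θ≡0 k n (n<3k+1 n≤k)) ,
  root-positive ξ₀ Θ≡0
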